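{- Let $\mathcal{S}=(Q,\mathcal{B})$ be a nested SQS$(v)$ in which all $\binom{v}{2}$ pairs of $Q$ are ND-pairs. Let $\mathcal{D}$ be the nested SQS$(2v)$ on $Q\times\{0,1\}$ whose blocks are: (Type I) $\{(x,i),(y,j),(z,k),(w,m)\}$ for $\{x,y,z,w\}\in\mathcal{B}$ and $i,j,k,m\in\mathbb{Z}_2$ with $i+j+k+m\equiv 0\pmod 2$, partitioned into $\{(x,i),(y,j)\}$ and $\{(z,k),(w,m)\}$ when $\{x,y,z,w\}$ is partitioned into $\{x,y\}$ and $\{z,w\}$ in $\mathcal{S}$; and (Type II) $\{(x,0),(x,1),(y,0),(y,1)\}$ for distinct $x,y\in Q$, partitioned into $\{(x,0),(x,1)\}$ and $\{(y,0),(y,1)\}$. Then for distinct $a,b\in Q$ and $i,j\in\{0,1\}$, the multiplicity of $\{(a,i),(b,j)\}$ in $\mathcal{D}$ (arising from Type I blocks) is $2\mu$, where $\mu$ is the multiplicity of $\{a,b\}$ in $\mathcal{S}$; and for each $a\in Q$ the pair $\{(a,0),(a,1)\}$ is an ND-pair of multiplicity $v-1$.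
   Context: A Steiner quadruple system SQS$(v)$ is a pair $(Q,\mathcal{B})$ where $Q$ is a set of $v$ points and $\mathcal{B}$ is a collection of 4-subsets of $Q$ (blocks) such that every 3-subset of $Q$ is contained in exactly one block. A nested SQS$(v)$ is an SQS$(v)$ together with a partition of each block into two 2-subsets (pairs). A pair of points is an ND-pair if it is one of the two pairs in the partition of at least one block; the multiplicity of a pair is the number of blocks whose partition contains that pair. (The block set described is Hanani's doubling construction of an SQS$(2v)$.) -}

module Defs where

open import Data.Nat using (ℕ; zero; suc; _+_; _<ᵇ_; _≤_)
open import Data.List.Membership.Propositional using (_∈_)
open import Data.Fin using (Fin; toℕ)
import Data.Fin.Properties as FinP
import Data.Bool.Properties as BoolP
open import Data.Bool using (Bool; true; false; _xor_; _∧_; _∨_; if_then_else_)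
open import Data.Product using (_×_; _,_)
open import Data.Product.Properties using (≡-dec)
open import Data.List using (List; []; _∷_; [_]; concatMap; _++_; allFin)
open import Relation.Nullary.Decidable using (⌊_⌋)
open import Relation.Binary.Definitions using (DecidableEquality)
open import Relation.Binary.PropositionalEquality using (_≡_; _≢_)

-- An (ordered representative of an) unordered pair, and a nested block:
-- a 4-set given together with its partition into two pairs.
Pair : Set → Set
Pair A = A × A

NBlock : Set → Set
NBlock A = Pair A × Pair A

module Generic {A : Set} (_≟_ : DecidableEquality A) where

  _==_ : A → A → Bool
  a == b = ⌊ a ≟ b ⌋

  samePair : Pair A → Pair A → Bool
  samePair (a , b) (c , d) = (a == c ∧ b == d) ∨ (a == d ∧ b == c)

  pairMult : List (NBlock A) → Pair A → ℕ
  pairMult [] p = zero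
  pairMult ((q , r) ∷ bs) p =
    (if samePair q p ∨ samePair r p then 1 else 0) + pairMult bs p

  IsNDPair : List (NBlock A) → Pair A → Set
  IsNDPair bs p = 1 ≤ pairMult bs p

  inBlock : A → NBlock A → Bool
  inBlock a ((x , y) , (z , w)) = a == x ∨ a == y ∨ a == z ∨ a == w

  tripleCount : List (NBlock A) → A → A → A → ℕ
  tripleCount [] a b c = zero
  tripleCount (bl ∷ bs) a b c =
    (if inBlock a bl ∧ inBlock b bl ∧ inBlock c bl then 1 else 0) + tripleCount bs a b c

  FourDistinct : NBlock A → Set
  FourDistinct ((x , y) , (z , w)) =
    x ≢ y × x ≢ z × x ≢ w × y ≢ z × y ≢ w × z ≢ w

  IsNestedSQS : List (NBlock A) → Set
  IsNestedSQS bs =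
    (∀ {bl} → bl ∈ bs → FourDistinct bl) ×
    (∀ a b c → a ≢ b → a ≢ c → b ≢ c → tripleCount bs a b c ≡ 1)



-- Point sets: Q = Fin v, doubled point set Q × Z₂ with Z₂ = Bool (false = 0).
module S (v : ℕ) = Generic (FinP._≟_ {v})

_≟D_ : {v : ℕ} → DecidableEquality (Fin v × Bool)
_≟D_ = ≡-dec FinP._≟_ BoolP._≟_

module D (v : ℕ) = Generic (_≟D_ {v})

bools : List Bool
bools = false ∷ true ∷ []

typeI : {v : ℕ} → NBlock (Fin v) → List (NBlock (Fin v × Bool))
typeI ((x , y) , (z , w)) =
  concatMap (λ i → concatMap (λ j → concatMap (λ k → concatMap (λ m →
    if i xor j xor k xor m
      then []
      else [ (((x , i) , (y , j)) , ((z , k) , (w , m))) ])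
    bools) bools) bools) bools

typeII : (v : ℕ) → List (NBlock (Fin v × Bool))
typeII v =
  concatMap (λ x → concatMap (λ y →
    if toℕ x <ᵇ toℕ y
      then [ (((x , false) , (x , true)) , ((y , false) , (y , true))) ]
      else [])
    (allFin v)) (allFin v)

doubling : (v : ℕ) → List (NBlock (Fin v)) → List (NBlock (Fin v × Bool))
doubling v bs = concatMap typeI bs ++ typeII v

{-# OPTIONS --safe #-}
-- Every lifted pair {(x,i),(y,j)} projects onto {x,y}. The eight Type I blocks over a block
-- {x,y | z,w} of S are indexed by the even quadruples (i,j,k,m), in which every (i,j) and every
-- (k,m) occurs exactly twice; so if {a,b} is a pair of that block, {(a,i′),(b,j′)} is a pair of
-- exactly two of them, and otherwise of none. The pair {(a,0),(a,1)} projects onto {a,a}, which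
-- is never a pair of a block of S. A Type II block {(x,0),(x,1) | (y,0),(y,1)} has only vertical
-- pairs, and {(a,0),(a,1)} is one of them exactly for the v − 1 two-subsets {x,y} containing a.
module Submission where

open import Defs
open import Algebra.Bundles using (CommutativeMonoid)
open import Data.Bool using (Bool; true; false; T; _∧_; _∨_; if_then_else_)
import Data.Bool.Properties as BoolP
open import Data.Bool.Properties using (T-∧; T-∨; ∧-zeroʳ; ∧-commutativeMonoid)
open import Algebra.Properties.CommutativeSemigroup
  (CommutativeMonoid.commutativeSemigroup ∧-commutativeMonoid) using (interchange)
open import Data.Empty using (⊥-elim)
open import Data.Fin using (Fin; zero; suc; toℕ)
import Data.Fin.Properties as FinP
open import Data.List using (List; []; _∷_; [_]; _++_; map; concatMap; tabulate)
open import Data.List.Properties using (map-cong)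
open import Data.List.Relation.Unary.All using (All; []; _∷_)
import Data.List.Relation.Unary.All as All
open import Data.Nat using (ℕ; zero; suc; _+_; _*_; _∸_; _≤_; _<ᵇ_)
open import Data.Nat.ListAction using (sum)
open import Data.Nat.Properties using (+-identityʳ; +-assoc; *-distribˡ-+; ∸-monoˡ-≤; +-0-monoid)
open import Data.Nat.Tactic.RingSolver using (solve-∀)
open import Algebra.Properties.Monoid.Sum +-0-monoid using (sum-syntax; sum-cong-≗; sum-replicate-zero)
open import Data.Product using (_×_; _,_; proj₁; proj₂)
import Data.Product as Product
open import Data.Sum using (_⊎_; inj₁; inj₂)
import Data.Sum as Sum
open import Function using (_∘_; id; Equivalence)
open import Relation.Nullary using (¬_)
open import Relation.Nullary.Decidable using (⌊_⌋; yes; no; toWitness; fromWitness)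
open import Relation.Binary.Definitions using (DecidableEquality)
open import Relation.Binary.PropositionalEquality
  using (_≡_; _≢_; refl; sym; trans; cong; cong₂; subst; module ≡-Reasoning)

open Equivalence using (to; from)

⟦_⟧ : Bool → ℕ
⟦ b ⟧ = if b then 1 else 0

⟦∨⟧ : ∀ {p q} → (T p → ¬ T q) → ⟦ p ∨ q ⟧ ≡ ⟦ p ⟧ + ⟦ q ⟧
⟦∨⟧ {false}         _    = refl
⟦∨⟧ {true}  {false} _    = refl
⟦∨⟧ {true}  {true}  p⇒¬q = ⊥-elim (p⇒¬q _ _)

⟦¬T⟧ : ∀ {p} → ¬ T p → ⟦ p ⟧ ≡ 0
⟦¬T⟧ {false} _  = refl
⟦¬T⟧ {true}  ¬p = ⊥-elim (¬p _)

∑-zero : ∀ {n} {f : Fin n → ℕ} → (∀ i → f i ≡ 0) → ∑[ i < n ] f i ≡ 0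
∑-zero {n} f≡0 = trans (sum-cong-≗ f≡0) (sum-replicate-zero n)

module PairMultiplicity {A : Set} (_≟_ : DecidableEquality A) where

  open Generic _≟_ public

  occurs : NBlock A → Pair A → Bool
  occurs (q , r) p = samePair q p ∨ samePair r p

  ==-∧-sound : ∀ {x y a b} → T (x == a ∧ y == b) → x ≡ a × y ≡ b
  ==-∧-sound {x} {y} {a} {b} = Product.map toWitness toWitness ∘ T-∧ {x == a} {y == b} .to

  private
    both-complete : ∀ {x y a b} → x ≡ a × y ≡ b → T (x == a ∧ y == b)
    both-complete {x} {y} {a} {b} = T-∧ {x == a} {y == b} .from ∘ Product.map fromWitness fromWitness

  samePair-sound : ∀ {x y a b} → T (samePair (x , y) (a , b)) →
                   (x ≡ a × y ≡ b) ⊎ (x ≡ b × y ≡ a)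
  samePair-sound {x} {y} {a} {b} =
    Sum.map ==-∧-sound ==-∧-sound ∘ T-∨ {x == a ∧ y == b} {x == b ∧ y == a} .to

  samePair-complete : ∀ {x y a b} → (x ≡ a × y ≡ b) ⊎ (x ≡ b × y ≡ a) →
                      T (samePair (x , y) (a , b))
  samePair-complete {x} {y} {a} {b} =
    T-∨ {x == a ∧ y == b} {x == b ∧ y == a} .from ∘ Sum.map both-complete both-complete

  samePair-disjoint : ∀ {x y z w p} → x ≢ z → x ≢ w →
                      T (samePair (x , y) p) → ¬ T (samePair (z , w) p)
  samePair-disjoint {p = a , b} x≢z x≢w xy~p zw~p
    with samePair-sound {a = a} {b} xy~p | samePair-sound {a = a} {b} zw~p
  ... | inj₁ (refl , _) | inj₁ (refl , _) = x≢z refl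
  ... | inj₁ (refl , _) | inj₂ (_ , refl) = x≢w refl
  ... | inj₂ (refl , _) | inj₁ (_ , refl) = x≢w refl
  ... | inj₂ (refl , _) | inj₂ (refl , _) = x≢z refl

  samePair-diagonal : ∀ {x y a} → x ≢ y → ¬ T (samePair (x , y) (a , a))
  samePair-diagonal x≢y xy~aa with samePair-sound xy~aa
  ... | inj₁ (refl , refl) = x≢y refl
  ... | inj₂ (refl , refl) = x≢y refl

  samePair-loop : ∀ {x a b} → T (samePair (x , x) (a , b)) → a ≡ b
  samePair-loop xx~ab with samePair-sound xx~ab
  ... | inj₁ (refl , refl) = refl
  ... | inj₂ (refl , refl) = refl

  pairMult-++ : ∀ bs cs p → pairMult (bs ++ cs) p ≡ pairMult bs p + pairMult cs p
  pairMult-++ []         cs p = refl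
  pairMult-++ (bl ∷ bs) cs p =
    trans (cong (⟦ occurs bl p ⟧ +_) (pairMult-++ bs cs p))
          (sym (+-assoc ⟦ occurs bl p ⟧ (pairMult bs p) (pairMult cs p)))

  pairMult-concatMap-tabulate : ∀ {X : Set} {n} (f : X → List (NBlock A)) (g : Fin n → X) p →
                                pairMult (concatMap f (tabulate g)) p ≡ ∑[ i < n ] pairMult (f (g i)) p
  pairMult-concatMap-tabulate {n = zero}  f g p = refl
  pairMult-concatMap-tabulate {n = suc n} f g p =
    trans (pairMult-++ (f (g zero)) _ p)
          (cong (pairMult (f (g zero)) p +_) (pairMult-concatMap-tabulate f (g ∘ suc) p))

  pairMult-if : ∀ c bl p → pairMult (if c then [ bl ] else []) p ≡ ⟦ c ∧ occurs bl p ⟧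
  pairMult-if false bl p = refl
  pairMult-if true  bl p = +-identityʳ _

  pairMult-absent : ∀ {bs p} → All (λ bl → ¬ T (occurs bl p)) bs → pairMult bs p ≡ 0
  pairMult-absent []             = refl
  pairMult-absent (¬occ ∷ absent) = cong₂ _+_ (⟦¬T⟧ ¬occ) (pairMult-absent absent)

  pairMult-diagonal : ∀ {bs a} → All FourDistinct bs → pairMult bs (a , a) ≡ 0
  pairMult-diagonal = pairMult-absent ∘ All.map absent
    where
    absent : ∀ {bl a} → FourDistinct bl → ¬ T (occurs bl (a , a))
    absent {(x , y) , (z , w)} {a} (x≢y , _ , _ , _ , _ , z≢w) =
      Sum.[ samePair-diagonal x≢y , samePair-diagonal z≢w ]
      ∘ T-∨ {samePair (x , y) (a , a)} {samePair (z , w) (a , a)} .to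

_==ᵇ_ : Bool → Bool → Bool
i ==ᵇ j = ⌊ i BoolP.≟ j ⌋

∑² : (Bool → Bool → ℕ) → ℕ
∑² f = (f false false + f false true) + (f true false + f true true)

∑²-cong : ∀ {f g} → (∀ i j → f i j ≡ g i j) → ∑² f ≡ ∑² g
∑²-cong f≡g = cong₂ _+_ (cong₂ _+_ (f≡g _ _) (f≡g _ _)) (cong₂ _+_ (f≡g _ _) (f≡g _ _))

∑²-match : ∀ p q i′ j′ → (T p → ¬ T q) →
           ∑² (λ i j → ⟦ (p ∧ (i ==ᵇ i′ ∧ j ==ᵇ j′)) ∨ (q ∧ (i ==ᵇ j′ ∧ j ==ᵇ i′)) ⟧)
             ≡ ⟦ p ∨ q ⟧
∑²-match false false _     _     _    = refl
∑²-match true  true  _     _     p⇒¬q = ⊥-elim (p⇒¬q _ _)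
∑²-match true  false false false _    = refl
∑²-match true  false false true  _    = refl
∑²-match true  false true  false _    = refl
∑²-match true  false true  true  _    = refl
∑²-match false true  false false _    = refl
∑²-match false true  false true  _    = refl
∑²-match false true  true  false _    = refl
∑²-match false true  true  true  _    = refl

-- Listed in the order in which typeI enumerates its blocks, so that the multiplicity of a pair
-- in typeI bl unfolds definitionally to a ∑even.
evenQuadruples : List (Bool × Bool × Bool × Bool)
evenQuadruples =
  (false , false , false , false) ∷ (false , false , true , true) ∷
  (false , true , false , true) ∷ (false , true , true , false) ∷
  (true , false , false , true) ∷ (true , false , true , false) ∷
  (true , true , false , false) ∷ (true , true , true , true) ∷ []

∑even : (Bool → Bool → Bool → Bool → ℕ) → ℕ
∑even c = sum (map (λ (i , j , k , m) → c i j k m) evenQuadruples)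

∑even-split : ∀ {c} f g → (∀ i j k m → c i j k m ≡ f i j + g k m) →
              ∑even c ≡ 2 * (∑² f + ∑² g)
∑even-split f g c≡f+g =
  trans (cong sum (map-cong (λ (i , j , k , m) → c≡f+g i j k m) evenQuadruples))
        (regroup (f false false) (f false true) (f true false) (f true true)
                 (g false false) (g false true) (g true false) (g true true))
  where
  regroup : ∀ f₀₀ f₀₁ f₁₀ f₁₁ g₀₀ g₀₁ g₁₀ g₁₁ →
    (f₀₀ + g₀₀) + ((f₀₀ + g₁₁) + ((f₀₁ + g₀₁) + ((f₀₁ + g₁₀) +
    ((f₁₀ + g₀₁) + ((f₁₀ + g₁₀) + ((f₁₁ + g₀₀) + ((f₁₁ + g₁₁) + 0)))))))
      ≡ 2 * (((f₀₀ + f₀₁) + (f₁₀ + f₁₁)) + ((g₀₀ + g₀₁) + (g₁₀ + g₁₁)))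
  regroup = solve-∀

module Base {v : ℕ} = PairMultiplicity (FinP._≟_ {v})
module Doubled {v : ℕ} = PairMultiplicity (_≟D_ {v})
open Base using (_==_)

==ᴰ-× : ∀ {v} (x : Fin v) i a j → (x , i) Doubled.== (a , j) ≡ (x == a) ∧ (i ==ᵇ j)
-- ⌊_⌋ does not compute through the Dec.map′ in ≡-dec, hence the split on the Bool components.
==ᴰ-× x i a j with x FinP.≟ a
... | no _ = refl
==ᴰ-× x false a false | yes refl = refl
==ᴰ-× x false a true  | yes refl = refl
==ᴰ-× x true  a false | yes refl = refl
==ᴰ-× x true  a true  | yes refl = refl

samePair-lift : ∀ {v} (x y a b : Fin v) i j i′ j′ →
  Doubled.samePair ((x , i) , (y , j)) ((a , i′) , (b , j′))
    ≡ ((x == a ∧ y == b) ∧ (i ==ᵇ i′ ∧ j ==ᵇ j′))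
      ∨ ((x == b ∧ y == a) ∧ (i ==ᵇ j′ ∧ j ==ᵇ i′))
samePair-lift x y a b i j i′ j′ = cong₂ _∨_
  (trans (cong₂ _∧_ (==ᴰ-× x i a i′) (==ᴰ-× y j b j′)) (interchange (x == a) _ _ _))
  (trans (cong₂ _∧_ (==ᴰ-× x i b j′) (==ᴰ-× y j a i′)) (interchange (x == b) _ _ _))

samePair-proj : ∀ {v} {x y a b : Fin v} {i j i′ j′} →
  T (Doubled.samePair ((x , i) , (y , j)) ((a , i′) , (b , j′))) →
  T (Base.samePair (x , y) (a , b))
samePair-proj {x = x} {y} {a} {b} {i} {j} {i′} {j′} =
  Base.samePair-complete ∘ Sum.map firsts firsts
  ∘ Doubled.samePair-sound {x = x , i} {y , j} {a , i′} {b , j′}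
  where
  firsts : ∀ {v} {x a y b : Fin v × Bool} →
           x ≡ a × y ≡ b → proj₁ x ≡ proj₁ a × proj₁ y ≡ proj₁ b
  firsts = Product.map (cong proj₁) (cong proj₁)

∑²-samePair-lift : ∀ {v} {x y : Fin v} → x ≢ y → ∀ a b i′ j′ →
  ∑² (λ i j → ⟦ Doubled.samePair ((x , i) , (y , j)) ((a , i′) , (b , j′)) ⟧)
    ≡ ⟦ Base.samePair (x , y) (a , b) ⟧
∑²-samePair-lift {x = x} {y} x≢y a b i′ j′ =
  trans (∑²-cong λ i j → cong ⟦_⟧ (samePair-lift x y a b i j i′ j′))
        (∑²-match (x == a ∧ y == b) (x == b ∧ y == a) i′ j′ crossed)
  where
  crossed : T (x == a ∧ y == b) → ¬ T (x == b ∧ y == a)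
  crossed xy~ab xy~ba
    with Base.==-∧-sound {x = x} {y} {a} {b} xy~ab | Base.==-∧-sound {x = x} {y} {b} {a} xy~ba
  ... | refl , _ | _ , refl = x≢y refl

pairMult-typeI : ∀ {v} {x y z w : Fin v} → Base.FourDistinct ((x , y) , (z , w)) → ∀ a b i′ j′ →
  Doubled.pairMult (typeI ((x , y) , (z , w))) ((a , i′) , (b , j′))
    ≡ 2 * ⟦ Base.occurs ((x , y) , (z , w)) (a , b) ⟧
pairMult-typeI {v} {x} {y} {z} {w} (x≢y , x≢z , x≢w , _ , _ , z≢w) a b i′ j′ = begin
  Doubled.pairMult (typeI ((x , y) , (z , w))) p
    ≡⟨⟩
  ∑even (λ i j k m → ⟦ xy i j ∨ zw k m ⟧)
    ≡⟨ ∑even-split (λ i j → ⟦ xy i j ⟧) (λ k m → ⟦ zw k m ⟧)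
                   (λ i j k m → ⟦∨⟧ {xy i j} {zw k m} (lifted-disjoint i j k m)) ⟩
  2 * (∑² (λ i j → ⟦ xy i j ⟧) + ∑² (λ k m → ⟦ zw k m ⟧))
    ≡⟨ cong (2 *_) (cong₂ _+_ (∑²-samePair-lift x≢y a b i′ j′)
                              (∑²-samePair-lift z≢w a b i′ j′)) ⟩
  2 * (⟦ Base.samePair (x , y) (a , b) ⟧ + ⟦ Base.samePair (z , w) (a , b) ⟧)
    ≡⟨ cong (2 *_) (sym (⟦∨⟧ disjoint)) ⟩
  2 * ⟦ Base.occurs ((x , y) , (z , w)) (a , b) ⟧ ∎
  where
  open ≡-Reasoning
  p : Pair (Fin v × Bool)
  p = (a , i′) , (b , j′)
  xy zw : Bool → Bool → Bool
  xy i j = Doubled.samePair ((x , i) , (y , j)) p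
  zw k m = Doubled.samePair ((z , k) , (w , m)) p
  disjoint : T (Base.samePair (x , y) (a , b)) → ¬ T (Base.samePair (z , w) (a , b))
  disjoint = Base.samePair-disjoint x≢z x≢w
  lifted-disjoint : ∀ i j k m → T (xy i j) → ¬ T (zw k m)
  lifted-disjoint i j k m xy~p zw~p =
    disjoint (samePair-proj {x = x} {y} {a} {b} {i} {j} xy~p)
             (samePair-proj {x = z} {w} {a} {b} {k} {m} zw~p)

pairMult-concatMap-typeI : ∀ {v} {B : List (NBlock (Fin v))} → All Base.FourDistinct B →
  ∀ a b i j →
  Doubled.pairMult (concatMap typeI B) ((a , i) , (b , j)) ≡ 2 * Base.pairMult B (a , b)
pairMult-concatMap-typeI []                     a b i j = refl
pairMult-concatMap-typeI {v} {bl ∷ B} (d ∷ ds) a b i j = begin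
  Doubled.pairMult (typeI bl ++ concatMap typeI B) p
    ≡⟨ Doubled.pairMult-++ (typeI bl) (concatMap typeI B) p ⟩
  Doubled.pairMult (typeI bl) p + Doubled.pairMult (concatMap typeI B) p
    ≡⟨ cong₂ _+_ (pairMult-typeI d a b i j) (pairMult-concatMap-typeI ds a b i j) ⟩
  2 * ⟦ Base.occurs bl (a , b) ⟧ + 2 * Base.pairMult B (a , b)
    ≡⟨ sym (*-distribˡ-+ 2 ⟦ Base.occurs bl (a , b) ⟧ (Base.pairMult B (a , b))) ⟩
  2 * Base.pairMult (bl ∷ B) (a , b) ∎
  where
  open ≡-Reasoning
  p : Pair (Fin v × Bool)
  p = (a , i) , (b , j)

==-suc : ∀ {n} (x a : Fin n) → suc x == suc a ≡ x == a
==-suc x a with x FinP.≟ a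
... | yes _ = refl
... | no _  = refl

∑-ones : ∀ n → ∑[ i < n ] 1 ≡ n
∑-ones zero    = refl
∑-ones (suc n) = cong suc (∑-ones n)

∑-singleton : ∀ {n} (a : Fin n) → ∑[ y < n ] ⟦ y == a ⟧ ≡ 1
∑-singleton {suc n} zero    = cong suc (∑-zero {n} λ _ → refl)
∑-singleton {suc n} (suc a) = trans (sum-cong-≗ λ y → cong ⟦_⟧ (==-suc y a)) (∑-singleton a)

∑-pairsContaining : ∀ n (a : Fin n) →
  ∑[ x < n ] ∑[ y < n ] ⟦ (toℕ x <ᵇ toℕ y) ∧ (x == a ∨ y == a) ⟧ ≡ n ∸ 1
∑-pairsContaining (suc n) zero =
  trans (cong₂ _+_ (∑-ones n)
                   (∑-zero {n} λ x → ∑-zero {n} λ y → cong ⟦_⟧ (∧-zeroʳ (toℕ x <ᵇ toℕ y))))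
        (+-identityʳ n)
∑-pairsContaining (suc (suc n)) (suc a) =
  cong₂ _+_ (trans (sum-cong-≗ λ y → cong ⟦_⟧ (==-suc y a)) (∑-singleton a))
            (trans (sum-cong-≗ λ x → sum-cong-≗ λ y →
                      cong (λ o → ⟦ (toℕ x <ᵇ toℕ y) ∧ o ⟧) (cong₂ _∨_ (==-suc x a) (==-suc y a)))
                   (∑-pairsContaining (suc n) a))

typeIIBlock : ∀ {v} → Fin v → Fin v → NBlock (Fin v × Bool)
typeIIBlock x y = ((x , false) , (x , true)) , ((y , false) , (y , true))

pairMult-typeII : ∀ v p → Doubled.pairMult (typeII v) p
                  ≡ ∑[ x < v ] ∑[ y < v ] ⟦ (toℕ x <ᵇ toℕ y) ∧ Doubled.occurs (typeIIBlock x y) p ⟧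
pairMult-typeII v p =
  trans (Doubled.pairMult-concatMap-tabulate {n = v} _ id p) (sum-cong-≗ λ x →
  trans (Doubled.pairMult-concatMap-tabulate {n = v} _ id p) (sum-cong-≗ λ y →
  Doubled.pairMult-if (toℕ x <ᵇ toℕ y) (typeIIBlock x y) p))

pairMult-typeII-offDiagonal : ∀ {v} {a b : Fin v} → a ≢ b → ∀ i j →
                              Doubled.pairMult (typeII v) ((a , i) , (b , j)) ≡ 0
pairMult-typeII-offDiagonal {v} {a} {b} a≢b i j =
  trans (pairMult-typeII v p) (∑-zero λ x → ∑-zero λ y → ⟦¬T⟧ (absent x y))
  where
  p : Pair (Fin v × Bool)
  p = (a , i) , (b , j)
  vertical-absent : ∀ x → ¬ T (Doubled.samePair ((x , false) , (x , true)) p)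
  vertical-absent x =
    a≢b ∘ Base.samePair-loop {x = x} ∘ samePair-proj {x = x} {x} {a} {b} {false} {true}
  absent : ∀ x y → ¬ T ((toℕ x <ᵇ toℕ y) ∧ Doubled.occurs (typeIIBlock x y) p)
  absent x y =
    Sum.[ vertical-absent x , vertical-absent y ]
    ∘ T-∨ {Doubled.samePair ((x , false) , (x , true)) p}
          {Doubled.samePair ((y , false) , (y , true)) p} .to
    ∘ proj₂ ∘ T-∧ {toℕ x <ᵇ toℕ y} {Doubled.occurs (typeIIBlock x y) p} .to

samePair-vertical : ∀ {v} (x a : Fin v) →
  Doubled.samePair ((x , false) , (x , true)) ((a , false) , (a , true)) ≡ x == a
samePair-vertical x a rewrite samePair-lift x x a a false true false true with x == a
... | true  = refl
... | false = refl

pairMult-typeII-vertical : ∀ {v} (a : Fin v) →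
  Doubled.pairMult (typeII v) ((a , false) , (a , true)) ≡ v ∸ 1
pairMult-typeII-vertical {v} a =
  trans (pairMult-typeII v _)
        (trans (sum-cong-≗ λ x → sum-cong-≗ λ y →
                  cong (λ o → ⟦ (toℕ x <ᵇ toℕ y) ∧ o ⟧)
                       (cong₂ _∨_ (samePair-vertical x a) (samePair-vertical y a)))
               (∑-pairsContaining v a))

lemma3p7 : (v : ℕ) → 2 ≤ v → (B : List (NBlock (Fin v))) →
    S.IsNestedSQS v B →
    (∀ a b → a ≢ b → S.IsNDPair v B (a , b)) →
    (∀ (a b : Fin v) → a ≢ b → ∀ (i j : Bool) →
        D.pairMult v (doubling v B) ((a , i) , (b , j)) ≡ 2 * S.pairMult v B (a , b))
    ×
    (∀ (a : Fin v) →
        D.IsNDPair v (doubling v B) ((a , false) , (a , true))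
        × D.pairMult v (doubling v B) ((a , false) , (a , true)) ≡ v ∸ 1)
lemma3p7 v 2≤v B (blocksDistinct , _) _ = offDiagonal , λ a → isNDPair a , vertical a
  where
  distinct : All Base.FourDistinct B
  distinct = All.tabulate blocksDistinct

  typeI+typeII : ∀ p → D.pairMult v (doubling v B) p
                       ≡ D.pairMult v (concatMap typeI B) p + D.pairMult v (typeII v) p
  typeI+typeII = Doubled.pairMult-++ (concatMap typeI B) (typeII v)

  offDiagonal : ∀ a b → a ≢ b → ∀ i j →
                D.pairMult v (doubling v B) ((a , i) , (b , j)) ≡ 2 * S.pairMult v B (a , b)
  offDiagonal a b a≢b i j =
    trans (typeI+typeII _)
          (trans (cong₂ _+_ (pairMult-concatMap-typeI distinct a b i j)
                            (pairMult-typeII-offDiagonal a≢b i j))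
                 (+-identityʳ _))

  vertical : ∀ a → D.pairMult v (doubling v B) ((a , false) , (a , true)) ≡ v ∸ 1
  vertical a =
    trans (typeI+typeII _)
          (cong₂ _+_ (trans (pairMult-concatMap-typeI distinct a a false true)
                            (cong (2 *_) (Base.pairMult-diagonal distinct)))
                     (pairMult-typeII-vertical a))

  isNDPair : ∀ a → D.IsNDPair v (doubling v B) ((a , false) , (a , true))
  isNDPair a = subst (1 ≤_) (sym (vertical a)) (∸-monoˡ-≤ 1 2≤v)
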